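{- Let $G$ be a finite, simple, connected graph with maximum degree $\Delta \ge 3$. Then $Z(G) \le (\Delta - 2)\beta(G) + 1$. Moreover, this bound is sharp: for every $\Delta \ge 3$ there exists a connected graph with maximum degree $\Delta$ attaining equality.
   Context: A vertex cover of $G$ is a set $C \subseteq V(G)$ such that every edge has at least one endpoint in $C$; $\beta(G)$ is the minimum cardinality of a vertex cover. Zero forcing process: starting from a set $B \subseteq V(G)$ of vertices colored blue (all others white), repeatedly, if a blue vertex has exactly one white neighbor, that neighbor is colored blue. $B$ is a zero forcing set if eventually all vertices become blue. $Z(G)$ is the minimum cardinality of a zero forcing set of $G$. -}

module Defs where

open import Data.Nat using (ℕ; _≤_; _≥_)
open import Data.Bool using (Bool; T)
open import Data.Fin using (Fin)
open import Data.Fin.Subset using (Subset; _∈_; ∣_∣)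
open import Data.Vec using (tabulate)
open import Data.Product using (Σ; ∃; _×_; _,_)
open import Data.Sum using (_⊎_)
open import Relation.Binary.PropositionalEquality using (_≡_; _≢_)

record Graph (n : ℕ) : Set where
  field
    adj       : Fin n → Fin n → Bool
    adj-sym   : ∀ u v → adj u v ≡ adj v u
    adj-irref : ∀ v → adj v v ≡ Data.Bool.false

open Graph public

Adj : ∀ {n} → Graph n → Fin n → Fin n → Set
Adj G u v = T (adj G u v)

degree : ∀ {n} → Graph n → Fin n → ℕ
degree G u = ∣ tabulate (adj G u) ∣

MaxDegree : ∀ {n} → Graph n → ℕ → Set
MaxDegree {n} G Δ = (∀ v → degree G v ≤ Δ) × (∃ λ v → degree G v ≡ Δ)

data Walk {n : ℕ} (G : Graph n) : Fin n → Fin n → Set where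
  here  : ∀ {u} → Walk G u u
  step  : ∀ {u v w} → Adj G u v → Walk G v w → Walk G u w

Connected : ∀ {n} → Graph n → Set
Connected G = ∀ u v → Walk G u v

IsVertexCover : ∀ {n} → Graph n → Subset n → Set
IsVertexCover G C = ∀ u v → Adj G u v → (u ∈ C) ⊎ (v ∈ C)

IsVertexCoverNumber : ∀ {n} → Graph n → ℕ → Set
IsVertexCoverNumber G b =
  (Σ _ λ C → IsVertexCover G C × ∣ C ∣ ≡ b) ×
  (∀ C → IsVertexCover G C → b ≤ ∣ C ∣)

-- Zero forcing: the set of vertices that eventually become blue starting
-- from B.
data Blue {n : ℕ} (G : Graph n) (B : Subset n) : Fin n → Set where
  initial : ∀ {v} → v ∈ B → Blue G B v
  force   : ∀ {u v} → Blue G B u → Adj G u v →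
            (∀ w → Adj G u w → w ≢ v → Blue G B w) → Blue G B v

IsZeroForcingSet : ∀ {n} → Graph n → Subset n → Set
IsZeroForcingSet G B = ∀ v → Blue G B v

IsZeroForcingNumber : ∀ {n} → Graph n → ℕ → Set
IsZeroForcingNumber G z =
  (Σ _ λ B → IsZeroForcingSet G B × ∣ B ∣ ≡ z) ×
  (∀ B → IsZeroForcingSet G B → z ≤ ∣ B ∣)

-- Fix a vertex cover C and grow an explored region R together with a seed set
-- B that forces all of R, adding one cover vertex c at a time.  The vertices
-- that join R with c are c and its pendant neighbours, i.e. those outside R ∪ C;
-- their other neighbours lie in C and can be treated as blue until explored.
-- With at most one pendant, seeding c suffices; otherwise seed all pendants but
-- one, so that a seeded pendant forces c and c forces the last pendant.  Each
-- new c beyond the first is adjacent to R (by connectivity and the closure of R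
-- under non-cover neighbours of cover vertices), so it has at most Δ − 1
-- pendants and costs at most Δ − 2 seeds; the first costs at most Δ − 1.
-- Equality holds for the star K₁,Δ.
module Submission where

open import Defs
open import Data.Nat using (ℕ; zero; suc; _≤_; _≥_; _<_; _+_; _*_; _∸_; z≤n; s≤s)
open import Data.Nat.Properties
  using (≤-reflexive; ≤-trans; <-≤-trans; ≤-pred; <⇒≱; +-suc; +-comm;
         +-monoʳ-≤; +-monoˡ-≤; +-cancelʳ-≤; *-monoʳ-≤; *-identityʳ; m≤m+n; module ≤-Reasoning)
open import Data.Nat.Tactic.RingSolver using (solve-∀)
open import Data.Bool using (Bool; true; false; T)
open import Data.Bool.Properties using (T-≡)
open import Data.Empty using (⊥-elim)
open import Data.Unit using (tt)
open import Data.Fin using (Fin; zero; suc; _≟_)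
open import Data.Fin.Properties using (any?; suc-injective)
open import Data.Fin.Subset
open import Data.Fin.Subset.Properties
  using (_∈?_; nonempty?; Empty-unique; ∣⊥∣≡0; ∣⊤∣≡n; ∈⊤; ∉⊥; x∈⁅x⁆; x∈⁅y⁆⇒x≡y; ∣⁅x⁆∣≡1;
         ∣p∣≤∣x∷p∣; p⊆q⇒∣p∣≤∣q∣; p⊂q⇒∣p∣<∣q∣; x∈p∩q⁺; x∈p∩q⁻; p∩q⊆p; ∣p∩q∣≤∣q∣;
         x∈p∪q⁺; x∈p∪q⁻; p⊆p∪q; q⊆p∪q; x∉p⇒x∈∁p; x∈∁p⇒x∉p; x∈p∧x≢y⇒x∈p-y; x∈p⇒∣p-x∣<∣p∣; ∣p∣≤n)
open import Data.Vec using ([]; _∷_; there; tabulate; replicate)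
open import Data.Vec.Properties using (lookup⇒[]=; []=⇒lookup; lookup∘tabulate)
open import Data.Product using (Σ; ∃; ∃₂; _×_; _,_; proj₁; proj₂)
open import Data.Sum using (_⊎_; inj₁; inj₂; [_,_]′; swap)
open import Function using (_∘_; Equivalence)
open import Relation.Nullary using (¬_; yes; no; ¬?; _×-dec_)
open import Relation.Nullary.Decidable using (decidable-stable)
open import Relation.Binary.PropositionalEquality
  using (_≡_; _≢_; refl; sym; trans; cong; cong₂; subst)

∣p∪q∣≤∣p∣+∣q∣ : ∀ {n} (p q : Subset n) → ∣ p ∪ q ∣ ≤ ∣ p ∣ + ∣ q ∣
∣p∪q∣≤∣p∣+∣q∣ []            []           = z≤n
∣p∪q∣≤∣p∣+∣q∣ (inside  ∷ p) (s ∷ q)      =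
  s≤s (≤-trans (∣p∪q∣≤∣p∣+∣q∣ p q) (+-monoʳ-≤ ∣ p ∣ (∣p∣≤∣x∷p∣ s q)))
∣p∪q∣≤∣p∣+∣q∣ (outside ∷ p) (inside ∷ q)  =
  ≤-trans (s≤s (∣p∪q∣≤∣p∣+∣q∣ p q)) (≤-reflexive (sym (+-suc ∣ p ∣ ∣ q ∣)))
∣p∪q∣≤∣p∣+∣q∣ (outside ∷ p) (outside ∷ q) = ∣p∪q∣≤∣p∣+∣q∣ p q

x∈p⇒0<∣p∣ : ∀ {n x} {p : Subset n} → x ∈ p → 0 < ∣ p ∣
x∈p⇒0<∣p∣ x∈p = <-≤-trans (s≤s z≤n) (x∈p⇒∣p-x∣<∣p∣ x∈p)

0<∣p∣⇒Nonempty : ∀ {n} (p : Subset n) → 0 < ∣ p ∣ → Nonempty p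
0<∣p∣⇒Nonempty {n} p 0<∣p∣ with nonempty? p
... | yes nonempty = nonempty
... | no empty     =
  ⊥-elim (<⇒≱ 0<∣p∣ (≤-reflexive (trans (cong ∣_∣ (Empty-unique empty)) (∣⊥∣≡0 n))))

⊆⊎∃∉ : ∀ {n} (p q : Subset n) → p ⊆ q ⊎ ∃ λ x → x ∈ p × x ∉ q
⊆⊎∃∉ p q with any? (λ x → (x ∈? p) ×-dec ¬? (x ∈? q))
... | yes witness = inj₂ witness
... | no none     = inj₁ λ {x} x∈p → decidable-stable (x ∈? q) (λ x∉q → none (x , x∈p , x∉q))

distinct⊎subsingleton : ∀ {n} (p : Subset n) →
  (∃₂ λ x y → x ∈ p × y ∈ p × x ≢ y) ⊎ (∀ {x y} → x ∈ p → y ∈ p → x ≡ y)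
distinct⊎subsingleton p with nonempty? p
... | no empty = inj₂ λ x∈p _ → ⊥-elim (empty (_ , x∈p))
... | yes (x , x∈p) with any? (λ y → (y ∈? p) ×-dec ¬? (y ≟ x))
...   | yes (y , y∈p , y≢x) = inj₁ (x , y , x∈p , y∈p , y≢x ∘ sym)
...   | no none             = inj₂ λ y∈p z∈p → trans (≡x y∈p) (sym (≡x z∈p))
  where
  ≡x : ∀ {y} → y ∈ p → y ≡ x
  ≡x {y} y∈p = decidable-stable (y ≟ x) (λ y≢x → none (y , y∈p , y≢x))

tabulate-const : ∀ {a} {A : Set a} n (x : A) → tabulate {n = n} (λ _ → x) ≡ replicate n x
tabulate-const zero    x = refl
tabulate-const (suc n) x = cong (x ∷_) (tabulate-const n x)

module _ {n} (G : Graph n) where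

  neighbours : Fin n → Subset n
  neighbours u = tabulate (adj G u)

  Adj⇒∈neighbours : ∀ {u v} → Adj G u v → v ∈ neighbours u
  Adj⇒∈neighbours {u} {v} u~v =
    lookup⇒[]= v (neighbours u) (trans (lookup∘tabulate (adj G u) v) (Equivalence.to T-≡ u~v))

  ∈neighbours⇒Adj : ∀ {u v} → v ∈ neighbours u → Adj G u v
  ∈neighbours⇒Adj {u} {v} v∈N =
    Equivalence.from T-≡ (trans (sym (lookup∘tabulate (adj G u) v)) ([]=⇒lookup v∈N))

  Adj-sym : ∀ {u v} → Adj G u v → Adj G v u
  Adj-sym {u} {v} = subst T (adj-sym G u v)

  Adj-irrefl : ∀ {v} → ¬ Adj G v v
  Adj-irrefl {v} = subst T (adj-irref G v)

  walk-leaves : ∀ (R : Subset n) {u v} → Walk G u v → u ∈ R → v ∉ R →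
                ∃₂ λ x y → x ∈ R × y ∉ R × Adj G x y
  walk-leaves R here               u∈R v∉R = ⊥-elim (v∉R u∈R)
  walk-leaves R (step {v = w} u~w walk) u∈R v∉R with w ∈? R
  ... | yes w∈R = walk-leaves R walk w∈R v∉R
  ... | no  w∉R = _ , w , u∈R , w∉R , u~w

  connected⇒neighbour : Connected G → ∀ {u₀ v₀} → Adj G u₀ v₀ → ∀ v → ∃ λ w → Adj G v w
  connected⇒neighbour connected {u₀} {v₀} u₀~v₀ v with connected v u₀
  ... | here         = v₀ , u₀~v₀
  ... | step v~w _   = _ , v~w

  -- Zero forcing from B inside a region R: vertices outside R count as blue, but
  -- only vertices of R may force.  Enlarging R therefore only requires checking
  -- the vertices that enter R next to a forcing vertex.
  data Forced (R B : Subset n) : Fin n → Set where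
    exterior  : ∀ {v} → v ∉ R → Forced R B v
    seed      : ∀ {v} → v ∈ B → Forced R B v
    propagate : ∀ {u v} → u ∈ R → Forced R B u → Adj G u v →
                (∀ w → Adj G u w → w ≢ v → Forced R B w) → Forced R B v

  Forced-grow : ∀ {R R′ B B′} → R ⊆ R′ → B ⊆ B′ →
    (∀ {u w} → u ∈ R → Adj G u w → w ∉ R → w ∈ R′ → Forced R′ B′ w) →
    ∀ {v} → Forced R B v → v ∈ R → Forced R′ B′ v
  Forced-grow R⊆R′ B⊆B′ entering (exterior v∉R) v∈R = ⊥-elim (v∉R v∈R)
  Forced-grow R⊆R′ B⊆B′ entering (seed v∈B)     _   = seed (B⊆B′ v∈B)
  Forced-grow {R} {R′} {B′ = B′} R⊆R′ B⊆B′ entering (propagate {u} {v} u∈R u-forced u~v others) _ =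
    propagate (R⊆R′ u∈R) (Forced-grow R⊆R′ B⊆B′ entering u-forced u∈R) u~v others′
    where
    others′ : ∀ w → Adj G u w → w ≢ v → Forced R′ B′ w
    others′ w u~w w≢v with w ∈? R | w ∈? R′
    ... | yes w∈R | _        = Forced-grow R⊆R′ B⊆B′ entering (others w u~w w≢v) w∈R
    ... | no  w∉R | yes w∈R′ = entering u∈R u~w w∉R w∈R′
    ... | no  _   | no w∉R′  = exterior w∉R′

  Forced⇒Blue : ∀ {R B} → (∀ v → v ∈ R) → ∀ {v} → Forced R B v → Blue G B v
  Forced⇒Blue everywhere (exterior v∉R)             = ⊥-elim (v∉R (everywhere _))
  Forced⇒Blue everywhere (seed v∈B)                 = initial v∈B
  Forced⇒Blue everywhere (propagate _ u-forced u~v others) =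
    force (Forced⇒Blue everywhere u-forced) u~v
          (λ w u~w w≢v → Forced⇒Blue everywhere (others w u~w w≢v))

module Exploration {n} (G : Graph n) (C : Subset n) (cover : IsVertexCover G C) where

  record Explored : Set where
    field
      region : Subset n
      seeds  : Subset n
      closed : ∀ {x y} → x ∈ region → x ∈ C → Adj G x y → y ∉ C → y ∈ region
      forced : ∀ {v} → v ∈ region → Forced G region seeds v

  open Explored public

  unexplored : Explored
  unexplored = record
    { region = ⊥ ; seeds = ⊥ ; closed = λ x∈⊥ → ⊥-elim (∉⊥ x∈⊥) ; forced = λ v∈⊥ → ⊥-elim (∉⊥ v∈⊥) }

  pendants : Subset n → Fin n → Subset n
  pendants R c = neighbours G c ∩ ∁ (R ∪ C)

  ∈pendants⁻ : ∀ {R c x} → x ∈ pendants R c → Adj G c x × x ∉ R × x ∉ C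
  ∈pendants⁻ x∈L with x∈p∩q⁻ _ _ x∈L
  ... | x∈N , x∈∁ = ∈neighbours⇒Adj G x∈N
                  , (λ x∈R → x∈∁p⇒x∉p x∈∁ (x∈p∪q⁺ (inj₁ x∈R)))
                  , (λ x∈C → x∈∁p⇒x∉p x∈∁ (x∈p∪q⁺ (inj₂ x∈C)))

  ∈pendants⁺ : ∀ {R c x} → Adj G c x → x ∉ R → x ∉ C → x ∈ pendants R c
  ∈pendants⁺ {R} c~x x∉R x∉C =
    x∈p∩q⁺ (Adj⇒∈neighbours G c~x , x∉p⇒x∈∁p (λ x∈R∪C → [ x∉R , x∉C ]′ (x∈p∪q⁻ R C x∈R∪C)))

  ∣pendants∣≤degree : ∀ R c → ∣ pendants R c ∣ ≤ degree G c
  ∣pendants∣≤degree R c = p⊆q⇒∣p∣≤∣q∣ (p∩q⊆p (neighbours G c) _)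

  ∣pendants∣<degree : ∀ {R c x} → x ∈ R → Adj G c x → ∣ pendants R c ∣ < degree G c
  ∣pendants∣<degree {R} {c} {x} x∈R c~x =
    <-≤-trans (s≤s (p⊆q⇒∣p∣≤∣q∣ pendants⊆N-x)) (x∈p⇒∣p-x∣<∣p∣ (Adj⇒∈neighbours G c~x))
    where
    pendants⊆N-x : pendants R c ⊆ neighbours G c - x
    pendants⊆N-x y∈L with ∈pendants⁻ y∈L
    ... | c~y , y∉R , _ = x∈p∧x≢y⇒x∈p-y (Adj⇒∈neighbours G c~y) (λ { refl → y∉R x∈R })

  module Step (s : Explored) {c} (c∈C : c ∈ C) (c∉R : c ∉ region s) where

    private
      R B L R′ : Subset n
      R  = region s
      B  = seeds s
      L  = pendants R c
      R′ = R ∪ ⁅ c ⁆ ∪ L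

    ∈R′⁻ : ∀ {x} → x ∈ R′ → x ∈ R ⊎ x ≡ c ⊎ x ∈ L
    ∈R′⁻ x∈R′ with x∈p∪q⁻ R _ x∈R′
    ... | inj₁ x∈R = inj₁ x∈R
    ... | inj₂ x∈cL with x∈p∪q⁻ ⁅ c ⁆ L x∈cL
    ...   | inj₁ x∈c = inj₂ (inj₁ (x∈⁅y⁆⇒x≡y c x∈c))
    ...   | inj₂ x∈L = inj₂ (inj₂ x∈L)

    R⊆R′ : R ⊆ R′
    R⊆R′ x∈R = x∈p∪q⁺ (inj₁ x∈R)

    c∈R′ : c ∈ R′
    c∈R′ = x∈p∪q⁺ (inj₂ (x∈p∪q⁺ (inj₁ (x∈⁅x⁆ c))))

    L⊆R′ : L ⊆ R′
    L⊆R′ x∈L = x∈p∪q⁺ (inj₂ (x∈p∪q⁺ (inj₂ x∈L)))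

    pendant-not-near-R : ∀ {u w} → u ∈ R → Adj G u w → w ∉ L
    pendant-not-near-R {u} {w} u∈R u~w w∈L with ∈pendants⁻ w∈L | cover u w u~w
    ... | _ , w∉R , w∉C | inj₁ u∈C = w∉R (closed s u∈R u∈C u~w w∉C)
    ... | _ , _   , w∉C | inj₂ w∈C = w∉C w∈C

    pendant-leaf : ∀ {x w} → x ∈ L → Adj G x w → w ≢ c → w ∉ R′
    pendant-leaf {x} {w} x∈L x~w w≢c w∈R′ with ∈R′⁻ w∈R′
    ... | inj₁ w∈R        = pendant-not-near-R w∈R (Adj-sym G x~w) x∈L
    ... | inj₂ (inj₁ w≡c) = w≢c w≡c
    ... | inj₂ (inj₂ w∈L) =
      [ proj₂ (proj₂ (∈pendants⁻ x∈L)) , proj₂ (proj₂ (∈pendants⁻ w∈L)) ]′ (cover x w x~w)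

    closed′ : ∀ {x y} → x ∈ R′ → x ∈ C → Adj G x y → y ∉ C → y ∈ R′
    closed′ {x} {y} x∈R′ x∈C x~y y∉C with ∈R′⁻ x∈R′
    ... | inj₁ x∈R         = R⊆R′ (closed s x∈R x∈C x~y y∉C)
    ... | inj₂ (inj₂ x∈L)  = ⊥-elim (proj₂ (proj₂ (∈pendants⁻ x∈L)) x∈C)
    ... | inj₂ (inj₁ refl) with y ∈? R
    ...   | yes y∈R = R⊆R′ y∈R
    ...   | no  y∉R = L⊆R′ (∈pendants⁺ x~y y∉R y∉C)

    R∩C⊂R′∩C : R ∩ C ⊂ R′ ∩ C
    R∩C⊂R′∩C = (λ x∈R∩C → let x∈R , x∈C = x∈p∩q⁻ R C x∈R∩C in x∈p∩q⁺ (R⊆R′ x∈R , x∈C))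
             , c , x∈p∩q⁺ (c∈R′ , c∈C) , (λ c∈R∩C → c∉R (p∩q⊆p R C c∈R∩C))

    module Seeded {B′} (B⊆B′ : B ⊆ B′) (c-forced : Forced G R′ B′ c) where

      R-forced : ∀ {v} → v ∈ R → Forced G R′ B′ v
      R-forced v∈R = Forced-grow G R⊆R′ B⊆B′ entering (forced s v∈R) v∈R
        where
        entering : ∀ {u w} → u ∈ R → Adj G u w → w ∉ R → w ∈ R′ → Forced G R′ B′ w
        entering u∈R u~w w∉R w∈R′ with ∈R′⁻ w∈R′
        ... | inj₁ w∈R         = ⊥-elim (w∉R w∈R)
        ... | inj₂ (inj₁ refl) = c-forced
        ... | inj₂ (inj₂ w∈L)  = ⊥-elim (pendant-not-near-R u∈R u~w w∈L)

      c-forces : ∀ {v} → v ∈ L → (∀ {w} → w ∈ L → w ≢ v → w ∈ B′) → Forced G R′ B′ v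
      c-forces {v} v∈L others-seeded = propagate c∈R′ c-forced (proj₁ (∈pendants⁻ v∈L)) others
        where
        others : ∀ w → Adj G c w → w ≢ v → Forced G R′ B′ w
        others w c~w w≢v with w ∈? R′
        ... | no w∉R′ = exterior w∉R′
        ... | yes w∈R′ with ∈R′⁻ w∈R′
        ...   | inj₁ w∈R         = R-forced w∈R
        ...   | inj₂ (inj₁ refl) = ⊥-elim (Adj-irrefl G c~w)
        ...   | inj₂ (inj₂ w∈L)  = seed (others-seeded w∈L w≢v)

      explored : (∀ {v} → v ∈ L → Forced G R′ B′ v) → Explored
      explored L-forced = record
        { region = R′ ; seeds = B′ ; closed = closed′ ; forced = R′-forced }
        where
        R′-forced : ∀ {v} → v ∈ R′ → Forced G R′ B′ v
        R′-forced v∈R′ with ∈R′⁻ v∈R′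
        ... | inj₁ v∈R         = R-forced v∈R
        ... | inj₂ (inj₁ refl) = c-forced
        ... | inj₂ (inj₂ v∈L)  = L-forced v∈L

    extension : ∀ {k} → 1 ≤ k → ∣ L ∣ ≤ suc k →
                Σ Explored λ s′ → R ∩ C ⊂ region s′ ∩ C × ∣ seeds s′ ∣ ≤ ∣ B ∣ + k
    extension {k} 1≤k ∣L∣≤1+k with distinct⊎subsingleton L
    ... | inj₂ subsingleton = explored L-forced , R∩C⊂R′∩C , cost
      where
      open Seeded {B ∪ ⁅ c ⁆} (λ x∈B → x∈p∪q⁺ (inj₁ x∈B)) (seed (x∈p∪q⁺ (inj₂ (x∈⁅x⁆ c))))

      L-forced : ∀ {v} → v ∈ L → Forced G R′ (B ∪ ⁅ c ⁆) v
      L-forced v∈L = c-forces v∈L (λ w∈L w≢v → ⊥-elim (w≢v (subsingleton w∈L v∈L)))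

      cost : ∣ B ∪ ⁅ c ⁆ ∣ ≤ ∣ B ∣ + k
      cost = ≤-trans (∣p∪q∣≤∣p∣+∣q∣ B ⁅ c ⁆) (+-monoʳ-≤ ∣ B ∣ (≤-trans (≤-reflexive (∣⁅x⁆∣≡1 c)) 1≤k))
    ... | inj₁ (x₀ , x₁ , x₀∈L , x₁∈L , x₀≢x₁) = explored L-forced , R∩C⊂R′∩C , cost
      where
      B′ : Subset n
      B′ = B ∪ (L - x₀)

      seeded : ∀ {v} → v ∈ L → v ≢ x₀ → v ∈ B′
      seeded v∈L v≢x₀ = x∈p∪q⁺ (inj₂ (x∈p∧x≢y⇒x∈p-y v∈L v≢x₀))

      c-forced : Forced G R′ B′ c
      c-forced = propagate (L⊆R′ x₁∈L) (seed (seeded x₁∈L (x₀≢x₁ ∘ sym)))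
                   (Adj-sym G (proj₁ (∈pendants⁻ x₁∈L)))
                   (λ w x₁~w w≢c → exterior (pendant-leaf x₁∈L x₁~w w≢c))

      open Seeded {B′} (λ x∈B → x∈p∪q⁺ (inj₁ x∈B)) c-forced

      L-forced : ∀ {v} → v ∈ L → Forced G R′ B′ v
      L-forced {v} v∈L with v ≟ x₀
      ... | yes refl = c-forces v∈L seeded
      ... | no v≢x₀  = seed (seeded v∈L v≢x₀)

      cost : ∣ B′ ∣ ≤ ∣ B ∣ + k
      cost = ≤-trans (∣p∪q∣≤∣p∣+∣q∣ B (L - x₀))
               (+-monoʳ-≤ ∣ B ∣ (≤-pred (<-≤-trans (x∈p⇒∣p-x∣<∣p∣ x₀∈L) ∣L∣≤1+k)))

  boundary∈C : ∀ (s : Explored) {x y} → x ∈ region s → y ∉ region s → Adj G x y → y ∈ C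
  boundary∈C s {x} {y} x∈R y∉R x~y = decidable-stable (y ∈? C) λ y∉C →
    [ (λ x∈C → y∉R (closed s x∈R x∈C x~y y∉C)) , y∉C ]′ (cover x y x~y)

  region-total : ∀ (s : Explored) → C ⊆ region s →
                 ∀ {u₀ v₀} → Connected G → Adj G u₀ v₀ → ∀ v → v ∈ region s
  region-total s C⊆R connected u₀~v₀ v with v ∈? C
  ... | yes v∈C = C⊆R v∈C
  ... | no  v∉C with connected⇒neighbour G connected u₀~v₀ v
  ...   | w , v~w =
    [ (λ v∈C → ⊥-elim (v∉C v∈C)) , (λ w∈C → closed s (C⊆R w∈C) w∈C (Adj-sym G v~w) v∉C) ]′
      (cover v w v~w)

budget-start : ∀ m {a r} → a ≤ suc (suc m) → 0 < r → a ≤ suc m * r + 1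
budget-start m {a} {r} a≤ 0<r = begin
  a                ≤⟨ a≤ ⟩
  suc (suc m)      ≡⟨ +-comm 1 (suc m) ⟩
  suc m + 1        ≡⟨ cong (_+ 1) (*-identityʳ (suc m)) ⟨
  suc m * 1 + 1    ≤⟨ +-monoˡ-≤ 1 (*-monoʳ-≤ (suc m) 0<r) ⟩
  suc m * r + 1    ∎
  where open ≤-Reasoning

budget-step : ∀ m {a a′ r r′} → a ≤ suc m * r + 1 → a′ ≤ a + suc m → r < r′ →
              a′ ≤ suc m * r′ + 1
budget-step m {a} {a′} {r} {r′} a≤ a′≤ r<r′ = begin
  a′                        ≤⟨ a′≤ ⟩
  a + suc m                 ≤⟨ +-monoˡ-≤ (suc m) a≤ ⟩
  suc m * r + 1 + suc m     ≡⟨ regroup m r ⟩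
  suc m * suc r + 1         ≤⟨ +-monoˡ-≤ 1 (*-monoʳ-≤ (suc m) r<r′) ⟩
  suc m * r′ + 1            ∎
  where
  open ≤-Reasoning
  regroup : ∀ m r → suc m * r + 1 + suc m ≡ suc m * suc r + 1
  regroup = solve-∀

module Saturation {n} (G : Graph n) (C : Subset n) (cover : IsVertexCover G C)
                  (connected : Connected G) (m : ℕ)
                  (degree≤ : ∀ v → degree G v ≤ suc (suc (suc m))) where

  open Exploration G C cover

  WithinBudget : Explored → Set
  WithinBudget s = ∣ seeds s ∣ ≤ suc m * ∣ region s ∩ C ∣ + 1

  ⊂∩⇒Nonempty : ∀ {p q r : Subset n} → p ⊂ q ∩ r → Nonempty q
  ⊂∩⇒Nonempty {q = q} {r} (_ , x , x∈q∩r , _) = x , p∩q⊆p q r x∈q∩r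

  extend : ∀ (s : Explored) → Nonempty (region s) → WithinBudget s →
           ∀ {c} → c ∉ region s →
           Σ Explored λ s′ → region s ∩ C ⊂ region s′ ∩ C × WithinBudget s′
  extend s (d , d∈R) within c∉R with walk-leaves G (region s) (connected d _) d∈R c∉R
  ... | x , y , x∈R , y∉R , x~y
    with Step.extension s (boundary∈C s x∈R y∉R x~y) y∉R (s≤s z≤n)
           (≤-pred (<-≤-trans (∣pendants∣<degree x∈R (Adj-sym G x~y)) (degree≤ y)))
  ...   | s′ , grows , cost = s′ , grows , budget-step m within cost (p⊂q⇒∣p∣<∣q∣ grows)

  saturate : ∀ fuel (s : Explored) → Nonempty (region s) → WithinBudget s →
             ∣ C ∣ ≤ fuel + ∣ region s ∩ C ∣ →
             Σ Explored λ s′ → C ⊆ region s′ × WithinBudget s′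
  saturate fuel s nonempty within ∣C∣≤ with ⊆⊎∃∉ C (region s)
  ... | inj₁ C⊆R = s , C⊆R , within
  saturate zero s nonempty within ∣C∣≤ | inj₂ (c , c∈C , c∉R) =
    ⊥-elim (<⇒≱ (p⊂q⇒∣p∣<∣q∣ R∩C⊂C) ∣C∣≤)
    where
    R∩C⊂C : region s ∩ C ⊂ C
    R∩C⊂C = (λ x∈R∩C → proj₂ (x∈p∩q⁻ (region s) C x∈R∩C))
          , c , c∈C , (λ c∈R∩C → c∉R (p∩q⊆p (region s) C c∈R∩C))
  saturate (suc fuel) s nonempty within ∣C∣≤ | inj₂ (c , c∈C , c∉R)
    with extend s nonempty within c∉R
  ... | s′ , grows , within′ =
    saturate fuel s′ (⊂∩⇒Nonempty grows) within′
      (≤-trans ∣C∣≤ (≤-trans (≤-reflexive (sym (+-suc fuel _))) (+-monoʳ-≤ fuel (p⊂q⇒∣p∣<∣q∣ grows))))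

  zeroForcingSet-within : ∀ {u₀ v₀} → Adj G u₀ v₀ →
    Σ (Subset n) λ B → IsZeroForcingSet G B × ∣ B ∣ ≤ suc m * ∣ C ∣ + 1
  zeroForcingSet-within {u₀} {v₀} u₀~v₀ = seeds s , forcing , bound
    where
    first-step : ∀ {c} → c ∈ C → Σ Explored λ s → Nonempty (region s) × WithinBudget s
    first-step {c} c∈C
      with Step.extension unexplored c∈C ∉⊥ (s≤s z≤n) (≤-trans (∣pendants∣≤degree ⊥ c) (degree≤ c))
    ... | s₁ , grows , cost =
      s₁ , ⊂∩⇒Nonempty grows ,
      budget-start m (≤-trans cost (≤-reflexive (cong (_+ suc (suc m)) (∣⊥∣≡0 n))))
                     (≤-trans (s≤s z≤n) (p⊂q⇒∣p∣<∣q∣ grows))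

    start : Σ Explored λ s → Nonempty (region s) × WithinBudget s
    start = [ first-step , first-step ]′ (cover u₀ v₀ u₀~v₀)

    saturated : Σ Explored λ s → C ⊆ region s × WithinBudget s
    saturated = let s₁ , nonempty , within = start in
      saturate n s₁ nonempty within (≤-trans (∣p∣≤n C) (m≤m+n n _))

    s : Explored
    s = proj₁ saturated

    everywhere : ∀ v → v ∈ region s
    everywhere = region-total s (proj₁ (proj₂ saturated)) connected u₀~v₀

    forcing : IsZeroForcingSet G (seeds s)
    forcing v = Forced⇒Blue G everywhere (forced s (everywhere v))

    bound : ∣ seeds s ∣ ≤ suc m * ∣ C ∣ + 1
    bound = ≤-trans (proj₂ (proj₂ saturated))
                    (+-monoˡ-≤ 1 (*-monoʳ-≤ (suc m) (∣p∩q∣≤∣q∣ (region s) C)))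

zeroForcingNumber-bound : (n : ℕ) (G : Graph n) (Δ z b : ℕ) → Connected G → MaxDegree G Δ → Δ ≥ 3 →
  IsZeroForcingNumber G z → IsVertexCoverNumber G b → z ≤ (Δ ∸ 2) * b + 1
zeroForcingNumber-bound n G (suc (suc (suc m))) z b connected (degree≤ , v , degree≡Δ) (s≤s (s≤s (s≤s _)))
                        (_ , minimal) ((C , cover , ∣C∣≡b) , _)
  with 0<∣p∣⇒Nonempty (neighbours G v) (subst (0 <_) (sym degree≡Δ) (s≤s z≤n))
... | w , w∈N with Saturation.zeroForcingSet-within G C cover connected m degree≤ (∈neighbours⇒Adj G w∈N)
...   | B , forcing , ∣B∣≤ = ≤-trans (minimal B forcing) (subst (λ β → ∣ B ∣ ≤ suc m * β + 1) ∣C∣≡b ∣B∣≤)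

star-adj : ∀ {k} → Fin (suc k) → Fin (suc k) → Bool
star-adj zero    zero    = false
star-adj zero    (suc _) = true
star-adj (suc _) zero    = true
star-adj (suc _) (suc _) = false

star : ∀ k → Graph (suc k)
star k = record { adj = star-adj ; adj-sym = symmetric ; adj-irref = irreflexive }
  where
  symmetric : ∀ u v → star-adj u v ≡ star-adj v u
  symmetric zero    zero    = refl
  symmetric zero    (suc _) = refl
  symmetric (suc _) zero    = refl
  symmetric (suc _) (suc _) = refl
  irreflexive : ∀ v → star-adj v v ≡ false
  irreflexive zero    = refl
  irreflexive (suc _) = refl

star-walk-from-centre : ∀ {k} v → Walk (star k) zero v
star-walk-from-centre zero    = here
star-walk-from-centre (suc _) = step tt here

star-connected : ∀ k → Connected (star k)
star-connected k zero    v = star-walk-from-centre v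
star-connected k (suc _) v = step tt (star-walk-from-centre v)

star-maxDegree : ∀ k → MaxDegree (star (suc k)) (suc k)
star-maxDegree k = degree≤ , zero , centre-degree
  where
  centre-degree : degree (star (suc k)) zero ≡ suc k
  centre-degree = trans (cong ∣_∣ (tabulate-const (suc k) true)) (∣⊤∣≡n (suc k))
  degree≤ : ∀ v → degree (star (suc k)) v ≤ suc k
  degree≤ zero    = ≤-reflexive centre-degree
  degree≤ (suc _) =
    s≤s (≤-trans (≤-reflexive (trans (cong ∣_∣ (tabulate-const (suc k) false)) (∣⊥∣≡0 (suc k)))) z≤n)

-- A leaf can only be forced by the centre, after every other leaf is blue.
star-blue-leaf : ∀ {k B i j} → Blue (star k) B (suc i) → i ≢ j → suc i ∈ B ⊎ suc j ∈ B
star-blue-leaf (initial i∈B) _ = inj₁ i∈B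
star-blue-leaf {j = j} (force {u = zero} _ _ others) i≢j =
  swap (star-blue-leaf (others (suc j) tt (i≢j ∘ sym ∘ suc-injective)) (i≢j ∘ sym))
star-blue-leaf (force {u = suc _} _ () _) _

star-white-leaf : ∀ {k B} → IsZeroForcingSet (star (suc k)) B → ∃ λ i₀ → ∀ i → i ≢ i₀ → suc i ∈ B
star-white-leaf {B = B} forcing with any? (λ i → ¬? (suc i ∈? B))
... | yes (i₀ , i₀∉B) = i₀ , λ i i≢i₀ →
  [ (λ i∈B → i∈B) , (λ i₀∈B → ⊥-elim (i₀∉B i₀∈B)) ]′ (star-blue-leaf (forcing (suc i)) i≢i₀)
... | no none = zero , λ i _ → decidable-stable (suc i ∈? B) (λ i∉B → none (i , i∉B))

star-zeroForcingNumber : ∀ j → IsZeroForcingNumber (star (suc (suc j))) (suc j)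
star-zeroForcingNumber j = (outside ∷ outside ∷ ⊤ , forcing , ∣⊤∣≡n (suc j)) , minimal
  where
  centre-blue : Blue (star (suc (suc j))) (outside ∷ outside ∷ ⊤) zero
  centre-blue = force {u = suc (suc zero)} (initial (there (there ∈⊤))) tt
                  λ { zero _ w≢0 → ⊥-elim (w≢0 refl) ; (suc _) () }

  forcing : IsZeroForcingSet (star (suc (suc j))) (outside ∷ outside ∷ ⊤)
  forcing zero          = centre-blue
  forcing (suc zero)    = force {u = zero} centre-blue tt
    λ { zero () ; (suc zero) _ w≢1 → ⊥-elim (w≢1 refl) ; (suc (suc _)) _ _ → initial (there (there ∈⊤)) }
  forcing (suc (suc _)) = initial (there (there ∈⊤))

  minimal : ∀ B → IsZeroForcingSet (star (suc (suc j))) B → suc j ≤ ∣ B ∣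
  minimal B forcing′ with star-white-leaf forcing′
  ... | i₀ , others∈B = +-cancelʳ-≤ 2 (suc j) ∣ B ∣ (begin
    suc j + 2                         ≡⟨ +-comm (suc j) 2 ⟩
    3 + j                             ≡⟨ ∣⊤∣≡n (3 + j) ⟨
    ∣ ⊤ {3 + j} ∣                     ≤⟨ p⊆q⇒∣p∣≤∣q∣ {p = ⊤} {q = B ∪ ends} (λ {v} _ → covered v) ⟩
    ∣ B ∪ ends ∣                      ≤⟨ ∣p∪q∣≤∣p∣+∣q∣ B ends ⟩
    ∣ B ∣ + ∣ ends ∣                  ≤⟨ +-monoʳ-≤ ∣ B ∣ (∣p∪q∣≤∣p∣+∣q∣ ⁅ centre ⁆ ⁅ suc i₀ ⁆) ⟩
    ∣ B ∣ + (∣ ⁅ centre ⁆ ∣ + ∣ ⁅ suc i₀ ⁆ ∣)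
      ≡⟨ cong (∣ B ∣ +_) (cong₂ _+_ (∣⁅x⁆∣≡1 centre) (∣⁅x⁆∣≡1 (suc i₀))) ⟩
    ∣ B ∣ + 2                         ∎)
    where
    open ≤-Reasoning
    centre : Fin (3 + j)
    centre = zero
    ends : Subset (3 + j)
    ends = ⁅ centre ⁆ ∪ ⁅ suc i₀ ⁆
    covered : ∀ v → v ∈ B ∪ ends
    covered zero = q⊆p∪q B ends (p⊆p∪q ⁅ suc i₀ ⁆ (x∈⁅x⁆ centre))
    covered (suc i) with i ≟ i₀
    ... | yes refl = q⊆p∪q B ends (q⊆p∪q ⁅ centre ⁆ ⁅ suc i₀ ⁆ (x∈⁅x⁆ (suc i)))
    ... | no i≢i₀  = p⊆p∪q ends (others∈B i i≢i₀)

star-vertexCoverNumber : ∀ k → IsVertexCoverNumber (star (suc k)) 1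
star-vertexCoverNumber k = (⁅ centre ⁆ , centre-covers , ∣⁅x⁆∣≡1 centre) , nonempty
  where
  centre : Fin (2 + k)
  centre = zero
  centre-covers : IsVertexCover (star (suc k)) ⁅ centre ⁆
  centre-covers zero    _       _  = inj₁ (x∈⁅x⁆ centre)
  centre-covers (suc _) zero    _  = inj₂ (x∈⁅x⁆ centre)
  centre-covers (suc _) (suc _) ()
  nonempty : ∀ C → IsVertexCover (star (suc k)) C → 1 ≤ ∣ C ∣
  nonempty C cover = [ x∈p⇒0<∣p∣ , x∈p⇒0<∣p∣ ]′ (cover zero (suc zero) tt)

star-attains-bound : (Δ : ℕ) → Δ ≥ 3 →
  Σ ℕ λ n → Σ (Graph n) λ G → Σ ℕ λ z → Σ ℕ λ b →
    Connected G × MaxDegree G Δ × IsZeroForcingNumber G z ×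
    IsVertexCoverNumber G b × z ≡ (Δ ∸ 2) * b + 1
star-attains-bound (suc (suc (suc m))) (s≤s (s≤s (s≤s _))) =
  _ , star (3 + m) , suc (suc m) , 1 ,
  star-connected (3 + m) , star-maxDegree (2 + m) , star-zeroForcingNumber (suc m) ,
  star-vertexCoverNumber (2 + m) ,
  trans (+-comm 1 (suc m)) (cong (_+ 1) (sym (*-identityʳ (suc m))))

theorem2 :
    ((n : ℕ) (G : Graph n) (Δ z b : ℕ) → Connected G → MaxDegree G Δ → Δ ≥ 3 →
      IsZeroForcingNumber G z → IsVertexCoverNumber G b →
      z ≤ (Δ ∸ 2) * b + 1)
    ×
    ((Δ : ℕ) → Δ ≥ 3 →
      Σ ℕ λ n → Σ (Graph n) λ G → Σ ℕ λ z → Σ ℕ λ b →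
        Connected G × MaxDegree G Δ × IsZeroForcingNumber G z ×
        IsVertexCoverNumber G b × z ≡ (Δ ∸ 2) * b + 1)
theorem2 = zeroForcingNumber-bound , star-attains-bound
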